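{- Let $\alpha$ be a positive integer, $0\le j<2^\alpha$, and $n$ a nonnegative integer. Then $$\sum_{\substack{0\le m\le n\\ m\equiv j\pmod{2^\alpha}}}(-1)^{\frac{m-j}{2^\alpha}}\binom{n}{m}\equiv 0\pmod{2^{\left\lfloor \frac{n}{2^\alpha}\right\rfloor}}.$$
   Context: $\binom{n}{m}$ is the ordinary binomial coefficient. -}

module Defs where

open import Data.Nat as ℕ using (ℕ; zero; suc; _∸_; _^_; _≟_)
open import Data.Nat.Properties using (m^n≢0)
open import Data.Nat.DivMod using (_/_; _%_)
open import Data.Nat.Combinatorics using (_C_)
open import Data.Integer as ℤ using (ℤ; +_; -_; _+_; _*_)
open import Relation.Nullary using (yes; no)

signℤ : ℕ → ℤ
signℤ zero = + 1
signℤ (suc k) = - signℤ k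

-- term for index m: if m ≡ j (mod 2^α) then (-1)^((m-j)/2^α) * C(n,m), else 0.
-- (For 0 ≤ j < 2^α, "m ≡ j mod 2^α" is exactly "m % 2^α = j", and then m ≥ j
--  and (m ∸ j)/2^α is the exact quotient (m-j)/2^α.)
term : (α j n m : ℕ) → ℤ
term α j n m with _%_ m (2 ^ α) {{m^n≢0 2 α}} ≟ j
... | yes _ = signℤ (_/_ (m ∸ j) (2 ^ α) {{m^n≢0 2 α}}) * (+ (n C m))
... | no  _ = + 0

partialSum : (α j n k : ℕ) → ℤ
partialSum α j n zero = + 0
partialSum α j n (suc k) = partialSum α j n k + term α j n k

altSum : (α j n : ℕ) → ℤ
altSum α j n = partialSum α j n (suc n)

floorDivPow2 : (n α : ℕ) → ℕ
floorDivPow2 n α = _/_ n (2 ^ α) {{m^n≢0 2 α}}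

{-# OPTIONS --safe #-}
-- Writing N = 2^α, the vector (altSum α j n)_{j<N} is the coefficient vector of (1 + x)^n
-- in ℤ[x]/(x^N + 1): it starts at δ = (1, 0, …, 0) and evolves by T = 1 + X, where X is
-- multiplication by x, i.e. the negacyclic shift.  For any additive X, (1 + X)^(2^a) ≡ 1 + X^(2^a) modulo 2, in the
-- sense that T^(2^a) v − v − X^(2^a) v is divisible by 2d whenever v is divisible by d.  As
-- X^N = −1, T^N therefore doubles the divisibility of every vector, and T^n δ is divisible by
-- 2^⌊n/N⌋.
module Submission where

open import Defs
open import Data.Nat using (ℕ; _<_; _^_)
open import Data.Integer using (+_)
open import Data.Integer.Divisibility using (_∣_)

import Data.Nat as ℕ
open import Data.Nat using (zero; suc; _∸_; _≤_; _≟_; NonZero; s≤s)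
import Data.Nat.Properties as ℕP
open import Data.Nat.DivMod
  using (_/_; _%_; m≡m%n+[m/n]*n; [m+kn]%n≡m%n; m<n⇒m%n≡m; n%n≡0; m%n<n; m%n≤m; %-pred-≡0;
         0/n≡0; m/n≡1+[m∸n]/n)
open import Data.Nat.Combinatorics using (_C_; k>n⇒nCk≡0; nCk+nC[k+1]≡[n+1]C[k+1])
open import Data.Integer using (ℤ; -_; _+_; _-_; _*_)
import Data.Integer.Properties as ℤP
import Data.Integer.Divisibility.Signed as Signed
open Signed using (divides; ∣m∣n⇒∣m+n; ∣m⇒∣-m; *-monoʳ-∣; ∣⇒∣ᵤ)
open import Data.Integer.Tactic.RingSolver using (solve-∀)
open import Data.Sum using (inj₁; inj₂)
open import Data.Empty using (⊥-elim)
open import Function using (_∘_)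
open import Relation.Binary.PropositionalEquality
open import Relation.Nullary using (yes; no)

Seq : Set
Seq = ℕ → ℤ

open import Function.Endo.Propositional Seq using (^-homo) renaming (_^_ to _^ᶠ_)

infixl 6 _⊕_

_⊕_ : Seq → Seq → Seq
(v ⊕ w) i = v i + w i

δ : Seq
δ zero    = + 1
δ (suc _) = + 0

record DividesOn (P : ℕ → Set) (d : ℤ) (v : Seq) : Set where
  constructor dividesOn
  field at : ∀ {i} → P i → d Signed.∣ v i
open DividesOn

private variable
  P : ℕ → Set
  d : ℤ
  v w : Seq

DividesOn-cong : v ≗ w → DividesOn P d v → DividesOn P d w
DividesOn-cong v≗w d∣v = dividesOn λ {i} p → subst (_ Signed.∣_) (v≗w i) (at d∣v p)

DividesOn-⊕ : DividesOn P d v → DividesOn P d w → DividesOn P d (v ⊕ w)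
DividesOn-⊕ d∣v d∣w = dividesOn λ p → ∣m∣n⇒∣m+n (at d∣v p) (at d∣w p)

DividesOn-double : DividesOn P d v → DividesOn P (+ 2 * d) (λ i → + 2 * v i)
DividesOn-double d∣v = dividesOn λ p → *-monoʳ-∣ (+ 2) (at d∣v p)

DividesOn-^ᶠ : ∀ {f : Seq → Seq} → (∀ {d v} → DividesOn P d v → DividesOn P d (f v)) →
               ∀ m → DividesOn P d v → DividesOn P d ((f ^ᶠ m) v)
DividesOn-^ᶠ f-∣ zero    d∣v = d∣v
DividesOn-^ᶠ f-∣ (suc m) d∣v = f-∣ (DividesOn-^ᶠ f-∣ m d∣v)

module FreshmansDream
    (X : Seq → Seq)
    (X-cong : ∀ {v w} → v ≗ w → X v ≗ X w)
    (X-⊕ : ∀ v w → X (v ⊕ w) ≗ X v ⊕ X w)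
    (X-∣ : ∀ {d v} → DividesOn P d v → DividesOn P d (X v))
  where

  T : Seq → Seq
  T v = v ⊕ X v

  T-∣ : DividesOn P d v → DividesOn P d (T v)
  T-∣ d∣v = DividesOn-⊕ d∣v (X-∣ d∣v)

  X^-cong : ∀ m → v ≗ w → (X ^ᶠ m) v ≗ (X ^ᶠ m) w
  X^-cong zero    v≗w = v≗w
  X^-cong (suc m) v≗w = X-cong (X^-cong m v≗w)

  X^-⊕ : ∀ m v w → (X ^ᶠ m) (v ⊕ w) ≗ (X ^ᶠ m) v ⊕ (X ^ᶠ m) w
  X^-⊕ zero    v w i = refl
  X^-⊕ (suc m) v w i = trans (X-cong (X^-⊕ m v w) i) (X-⊕ _ _ i)

  defect : ℕ → Seq → Seq
  defect m v i = (T ^ᶠ m) v i - v i - (X ^ᶠ m) v i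

  -- Expand T^(2m) = T^m ∘ T^m using T^m = 1 + X^m + defect m.
  defect-+-self : ∀ m v → defect (m ℕ.+ m) v ≗
    defect m ((T ^ᶠ m) v) ⊕ defect m v ⊕ ((X ^ᶠ m) (defect m v) ⊕ (λ i → + 2 * (X ^ᶠ m) v i))
  defect-+-self m v i = begin
    (T ^ᶠ (m ℕ.+ m)) v i - v i - (X ^ᶠ (m ℕ.+ m)) v i
      ≡⟨ cong₂ (λ s t → s - v i - t) (cong (λ f → f v i) (^-homo T m m))
                                     (cong (λ f → f v i) (^-homo X m m)) ⟩
    Tᵐ u i - v i - Xᵐ (Xᵐ v) i
      ≡⟨ cong (λ s → s - v i - Xᵐ (Xᵐ v) i) (split (Tᵐ u i) (u i) (Xᵐ u i)) ⟩
    u i + Xᵐ u i + e u i - v i - Xᵐ (Xᵐ v) i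
      ≡⟨ cong₂ (λ s t → s + t + e u i - v i - Xᵐ (Xᵐ v) i) (u-split i) Xᵐu-split ⟩
    v i + Xᵐ v i + e v i + (Xᵐ v i + Xᵐ (Xᵐ v) i + Xᵐ (e v) i) + e u i - v i - Xᵐ (Xᵐ v) i
      ≡⟨ rearrange (v i) (Xᵐ v i) (Xᵐ (Xᵐ v) i) (e v i) (Xᵐ (e v) i) (e u i) ⟩
    e u i + e v i + (Xᵐ (e v) i + + 2 * Xᵐ v i) ∎
    where
      open ≡-Reasoning
      Tᵐ Xᵐ e : Seq → Seq
      Tᵐ = T ^ᶠ m
      Xᵐ = X ^ᶠ m
      e = defect m
      u : Seq
      u = Tᵐ v
      split : ∀ (a b c : ℤ) → a ≡ b + c + (a - b - c)
      split = solve-∀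
      u-split : u ≗ v ⊕ Xᵐ v ⊕ e v
      u-split j = split (u j) (v j) (Xᵐ v j)
      Xᵐu-split : Xᵐ u i ≡ Xᵐ v i + Xᵐ (Xᵐ v) i + Xᵐ (e v) i
      Xᵐu-split = trans (X^-cong m u-split i)
                        (trans (X^-⊕ m (v ⊕ Xᵐ v) (e v) i) (cong (_+ Xᵐ (e v) i) (X^-⊕ m v (Xᵐ v) i)))
      rearrange : ∀ (a x y b z c : ℤ) →
        a + x + b + (x + y + z) + c - a - y ≡ c + b + (z + + 2 * x)
      rearrange = solve-∀

  defect-∣ : ∀ a → DividesOn P d v → DividesOn P (+ 2 * d) (defect (2 ^ a) v)
  defect-∣ {v = v} zero d∣v = dividesOn λ {i} _ →
    subst (_ Signed.∣_) (sym (cancel (v i) (X v i))) (divides (+ 0) refl)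
    where
      cancel : ∀ (a b : ℤ) → a + b - a - b ≡ + 0
      cancel = solve-∀
  defect-∣ {d = d} {v = v} (suc a) d∣v =
    subst (λ m → DividesOn P (+ 2 * d) (defect m v)) (cong (2 ^ a ℕ.+_) (sym (ℕP.+-identityʳ (2 ^ a))))
      (DividesOn-cong (λ i → sym (defect-+-self (2 ^ a) v i))
        (DividesOn-⊕ (DividesOn-⊕ (defect-∣ a (DividesOn-^ᶠ T-∣ (2 ^ a) d∣v)) (defect-∣ a d∣v))
                     (DividesOn-⊕ (DividesOn-^ᶠ X-∣ (2 ^ a) (defect-∣ a d∣v))
                                  (DividesOn-double (DividesOn-^ᶠ X-∣ (2 ^ a) d∣v)))))

binomialPartial : (ℕ → ℤ) → ℕ → ℕ → ℤ
binomialPartial f n zero    = + 0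
binomialPartial f n (suc k) = binomialPartial f n k + f k * + (n C k)

binomialSum : (ℕ → ℤ) → ℕ → ℤ
binomialSum f n = binomialPartial f n (suc n)

binomialPartial-cong : ∀ {f g} → f ≗ g → ∀ n k → binomialPartial f n k ≡ binomialPartial g n k
binomialPartial-cong f≗g n zero    = refl
binomialPartial-cong f≗g n (suc k) =
  cong₂ (λ s x → s + x * + (n C k)) (binomialPartial-cong f≗g n k) (f≗g k)

binomialPartial-neg : ∀ f n k → binomialPartial (-_ ∘ f) n k ≡ - binomialPartial f n k
binomialPartial-neg f n zero    = refl
binomialPartial-neg f n (suc k) = begin
  binomialPartial (-_ ∘ f) n k + - f k * + (n C k)
    ≡⟨ cong₂ _+_ (binomialPartial-neg f n k) (sym (ℤP.neg-distribˡ-* (f k) _)) ⟩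
  - binomialPartial f n k + - (f k * + (n C k))
    ≡⟨ sym (ℤP.neg-distrib-+ (binomialPartial f n k) _) ⟩
  - (binomialPartial f n k + f k * + (n C k)) ∎
  where open ≡-Reasoning

binomialPartial-pascal : ∀ f n k →
  binomialPartial f (suc n) (suc k) ≡ binomialPartial f n (suc k) + binomialPartial (f ∘ suc) n k
binomialPartial-pascal f n zero    = sym (ℤP.+-identityʳ _)
binomialPartial-pascal f n (suc k) = begin
  binomialPartial f (suc n) (suc k) + f (suc k) * + (suc n C suc k)
    ≡⟨ cong₂ _+_ (binomialPartial-pascal f n k)
                 (cong (λ c → f (suc k) * c) (sym pascal)) ⟩
  (binomialPartial f n (suc k) + binomialPartial (f ∘ suc) n k)
    + f (suc k) * (+ (n C k) + + (n C suc k))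
    ≡⟨ rearrange (binomialPartial f n (suc k)) (binomialPartial (f ∘ suc) n k) (f (suc k)) _ _ ⟩
  (binomialPartial f n (suc k) + f (suc k) * + (n C suc k))
    + (binomialPartial (f ∘ suc) n k + f (suc k) * + (n C k)) ∎
  where
    open ≡-Reasoning
    pascal : + (n C k) + + (n C suc k) ≡ + (suc n C suc k)
    pascal = cong +_ (nCk+nC[k+1]≡[n+1]C[k+1] n k)
    rearrange : ∀ (a b x p q : ℤ) → (a + b) + x * (p + q) ≡ (a + x * q) + (b + x * p)
    rearrange = solve-∀

binomialSum-suc : ∀ f n → binomialSum f (suc n) ≡ binomialSum f n + binomialSum (f ∘ suc) n
binomialSum-suc f n = begin
  binomialPartial f (suc n) (suc (suc n))
    ≡⟨ binomialPartial-pascal f n (suc n) ⟩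
  binomialSum f n + f (suc n) * + (n C suc n) + binomialSum (f ∘ suc) n
    ≡⟨ cong (λ c → binomialSum f n + f (suc n) * + c + binomialSum (f ∘ suc) n)
            (k>n⇒nCk≡0 (ℕP.n<1+n n)) ⟩
  binomialSum f n + f (suc n) * + 0 + binomialSum (f ∘ suc) n
    ≡⟨ cong (_+ binomialSum (f ∘ suc) n) (drop (binomialSum f n) (f (suc n))) ⟩
  binomialSum f n + binomialSum (f ∘ suc) n ∎
  where
    open ≡-Reasoning
    drop : ∀ (a b : ℤ) → a + b * + 0 ≡ a
    drop = solve-∀

module Negacyclic (N : ℕ) .{{_ : NonZero N}} where

  -- An element of ℤ[x]/(x^N + 1) is the first N entries of a Seq; later entries are ignored.
  X : Seq → Seq
  X v zero    = - v (N ∸ 1)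
  X v (suc i) = v i

  suc[N∸1]≡N : suc (N ∸ 1) ≡ N
  suc[N∸1]≡N = ℕP.m+[n∸m]≡n (ℕ.>-nonZero⁻¹ N)

  N∸1<N : N ∸ 1 < N
  N∸1<N = ℕP.≤-reflexive suc[N∸1]≡N

  X-cong : v ≗ w → X v ≗ X w
  X-cong v≗w zero    = cong -_ (v≗w (N ∸ 1))
  X-cong v≗w (suc i) = v≗w i

  X-⊕ : ∀ v w → X (v ⊕ w) ≗ X v ⊕ X w
  X-⊕ v w zero    = ℤP.neg-distrib-+ (v (N ∸ 1)) (w (N ∸ 1))
  X-⊕ v w (suc i) = refl

  X-∣ : DividesOn (_< N) d v → DividesOn (_< N) d (X v)
  X-∣ {d} {v} d∣v = dividesOn d∣Xv
    where
      d∣Xv : ∀ {i} → i < N → d Signed.∣ X v i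
      d∣Xv {zero}  _     = ∣m⇒∣-m (at d∣v N∸1<N)
      d∣Xv {suc i} 1+i<N = at d∣v (ℕP.<-trans (ℕP.n<1+n i) 1+i<N)

  open FreshmansDream X X-cong X-⊕ X-∣ public

  T-agree : (∀ {i} → i < N → v i ≡ w i) → ∀ {i} → i < N → T v i ≡ T w i
  T-agree v≈w {zero}  i<N   = cong₂ _+_ (v≈w i<N) (cong -_ (v≈w N∸1<N))
  T-agree v≈w {suc i} 1+i<N = cong₂ _+_ (v≈w 1+i<N) (v≈w (ℕP.<-trans (ℕP.n<1+n i) 1+i<N))

  X^-shift : ∀ m i v → (X ^ᶠ m) v (i ℕ.+ m) ≡ v i
  X^-shift zero    i v = cong v (ℕP.+-identityʳ i)
  X^-shift (suc m) i v rewrite ℕP.+-suc i m = X^-shift m i v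

  X^N≡-id : ∀ v {i} → i < N → (X ^ᶠ N) v i ≡ - v i
  X^N≡-id v {i} i<N = begin
    (X ^ᶠ N) v i                           ≡⟨ cong (λ m → (X ^ᶠ m) v i) N≡i+[1+k] ⟩
    (X ^ᶠ (i ℕ.+ suc k)) v i               ≡⟨ cong (λ f → f v i) (^-homo X i (suc k)) ⟩
    (X ^ᶠ i) ((X ^ᶠ suc k) v) (0 ℕ.+ i)    ≡⟨ X^-shift i 0 _ ⟩
    - (X ^ᶠ k) v (N ∸ 1)                   ≡⟨ cong (λ j → - (X ^ᶠ k) v j) (cong (_∸ 1) N≡1+i+k) ⟩
    - (X ^ᶠ k) v (i ℕ.+ k)                 ≡⟨ cong -_ (X^-shift k i v) ⟩
    - v i ∎
    where
      open ≡-Reasoning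
      k : ℕ
      k = N ∸ suc i
      N≡1+i+k : N ≡ suc (i ℕ.+ k)
      N≡1+i+k = sym (ℕP.m+[n∸m]≡n i<N)
      N≡i+[1+k] : N ≡ i ℕ.+ suc k
      N≡i+[1+k] = trans N≡1+i+k (sym (ℕP.+-suc i k))

  binomialSum-X : ∀ (e : ℕ → Seq) n i →
    binomialSum (λ m → X (e m) i) n ≡ X (λ j → binomialSum (λ m → e m j) n) i
  binomialSum-X e n zero    = binomialPartial-neg (λ m → e m (N ∸ 1)) n (suc n)
  binomialSum-X e n (suc i) = refl

  T^N≡defect : ∀ v {i} → i < N → (T ^ᶠ N) v i ≡ defect N v i
  T^N≡defect v {i} i<N = sym (trans (cong (λ x → (T ^ᶠ N) v i - v i - x) (X^N≡-id v i<N))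
                                    (cancel ((T ^ᶠ N) v i) (v i)))
    where
      cancel : ∀ (a b : ℤ) → a - b - - b ≡ a
      cancel = solve-∀

  module _ (a : ℕ) (2^a≡N : 2 ^ a ≡ N) where

    T^N-∣ : DividesOn (_< N) d v → DividesOn (_< N) (+ 2 * d) ((T ^ᶠ N) v)
    T^N-∣ {d} {v} d∣v = dividesOn λ i<N →
      subst (_ Signed.∣_) (sym (T^N≡defect v i<N)) (at 2d∣defect i<N)
      where
        2d∣defect : DividesOn (_< N) (+ 2 * d) (defect N v)
        2d∣defect = subst (λ m → DividesOn (_< N) (+ 2 * d) (defect m v)) 2^a≡N (defect-∣ a d∣v)

    T^[q*N]δ-∣ : ∀ q → DividesOn (_< N) (+ (2 ^ q)) ((T ^ᶠ (q ℕ.* N)) δ)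
    T^[q*N]δ-∣ zero    = dividesOn λ {i} _ → divides (δ i) (sym (ℤP.*-identityʳ (δ i)))
    T^[q*N]δ-∣ (suc q) =
      subst₂ (DividesOn (_< N)) (sym (ℤP.pos-* 2 (2 ^ q))) (cong (λ f → f δ) (sym (^-homo T N (q ℕ.* N))))
        (T^N-∣ (T^[q*N]δ-∣ q))

    T^nδ-∣ : ∀ n → DividesOn (_< N) (+ (2 ^ (n / N))) ((T ^ᶠ n) δ)
    T^nδ-∣ n = subst (DividesOn (_< N) _) (sym T^n≡T^r∘T^qN) (DividesOn-^ᶠ T-∣ (n % N) (T^[q*N]δ-∣ (n / N)))
      where
        T^n≡T^r∘T^qN : (T ^ᶠ n) δ ≡ (T ^ᶠ (n % N)) ((T ^ᶠ (n / N ℕ.* N)) δ)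
        T^n≡T^r∘T^qN = trans (cong (λ m → (T ^ᶠ m) δ) (m≡m%n+[m/n]*n n N))
                             (cong (λ f → f δ) (^-homo T (n % N) (n / N ℕ.* N)))

module AlternatingSum (α : ℕ) where

  N : ℕ
  N = 2 ^ α

  instance
    N≢0 : NonZero N
    N≢0 = ℕP.m^n≢0 2 α

  open Negacyclic N public

  coeff : ℕ → ℕ → ℤ
  coeff j m with m % N ≟ j
  ... | yes _ = signℤ ((m ∸ j) / N)
  ... | no  _ = + 0

  term≡coeff*C : ∀ j n m → term α j n m ≡ coeff j m * + (n C m)
  term≡coeff*C j n m with m % N ≟ j
  ... | yes _ = refl
  ... | no  _ = sym (ℤP.*-zeroˡ (+ (n C m)))

  partialSum≡binomialPartial : ∀ j n k → partialSum α j n k ≡ binomialPartial (coeff j) n k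
  partialSum≡binomialPartial j n zero    = refl
  partialSum≡binomialPartial j n (suc k) =
    cong₂ _+_ (partialSum≡binomialPartial j n k) (term≡coeff*C j n k)

  altSum≡binomialSum : ∀ j n → altSum α j n ≡ binomialSum (coeff j) n
  altSum≡binomialSum j n = partialSum≡binomialPartial j n (suc n)

  0%N≡0 : 0 % N ≡ 0
  0%N≡0 = m<n⇒m%n≡m (ℕ.>-nonZero⁻¹ N)

  [1+m]%N≡[1+m%N]%N : ∀ m → suc m % N ≡ suc (m % N) % N
  [1+m]%N≡[1+m%N]%N m = trans (cong (λ t → suc t % N) (m≡m%n+[m/n]*n m N))
                              ([m+kn]%n≡m%n (suc (m % N)) (m / N) N)

  [1+m]%N≡1+j⇒m%N≡j : ∀ {m j} → suc m % N ≡ suc j → m % N ≡ j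
  [1+m]%N≡1+j⇒m%N≡j {m} eq with ℕP.m≤n⇒m<n∨m≡n (m%n<n m N)
  ... | inj₁ 1+r<N = ℕP.suc-injective
    (trans (sym (m<n⇒m%n≡m 1+r<N)) (trans (sym ([1+m]%N≡[1+m%N]%N m)) eq))
  ... | inj₂ 1+r≡N = ⊥-elim (ℕP.0≢1+n
    (trans (sym (n%n≡0 N)) (trans (cong (_% N) (sym 1+r≡N)) (trans (sym ([1+m]%N≡[1+m%N]%N m)) eq))))

  m%N≡j⇒[1+m]%N≡1+j : ∀ {m j} → suc j < N → m % N ≡ j → suc m % N ≡ suc j
  m%N≡j⇒[1+m]%N≡1+j {m} 1+j<N eq =
    trans ([1+m]%N≡[1+m%N]%N m) (trans (cong (λ r → suc r % N) eq) (m<n⇒m%n≡m 1+j<N))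

  m%N≡N∸1⇒[1+m]%N≡0 : ∀ {m} → m % N ≡ N ∸ 1 → suc m % N ≡ 0
  m%N≡N∸1⇒[1+m]%N≡0 {m} eq = begin
    suc m % N         ≡⟨ [1+m]%N≡[1+m%N]%N m ⟩
    suc (m % N) % N   ≡⟨ cong (λ r → suc r % N) eq ⟩
    suc (N ∸ 1) % N   ≡⟨ cong (_% N) suc[N∸1]≡N ⟩
    N % N             ≡⟨ n%n≡0 N ⟩
    0 ∎
    where open ≡-Reasoning

  m%N≡N∸1⇒[1+m]/N : ∀ {m} → m % N ≡ N ∸ 1 → suc m / N ≡ suc ((m ∸ (N ∸ 1)) / N)
  m%N≡N∸1⇒[1+m]/N {m} eq = trans (m/n≡1+[m∸n]/n N≤1+m) (cong (λ t → suc ((suc m ∸ t) / N)) (sym suc[N∸1]≡N))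
    where
      N≤1+m : N ≤ suc m
      N≤1+m = subst (_≤ suc m) suc[N∸1]≡N (s≤s (subst (_≤ m) eq (m%n≤m m N)))

  coeff-zero : ∀ j → coeff j 0 ≡ δ j
  coeff-zero zero with 0 % N ≟ 0
  ... | yes _ = cong signℤ (0/n≡0 N)
  ... | no  ¬p = ⊥-elim (¬p 0%N≡0)
  coeff-zero (suc j) with 0 % N ≟ suc j
  ... | yes p = ⊥-elim (ℕP.0≢1+n (trans (sym 0%N≡0) p))
  ... | no  _ = refl

  coeff-suc : ∀ m {j} → j < N → coeff j (suc m) ≡ X (λ i → coeff i m) j
  coeff-suc m {zero} _ with suc m % N ≟ 0 | m % N ≟ N ∸ 1
  ... | yes _ | yes q  = cong signℤ (m%N≡N∸1⇒[1+m]/N q)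
  ... | yes p | no ¬q  = ⊥-elim (¬q (%-pred-≡0 p))
  ... | no ¬p | yes q  = ⊥-elim (¬p (m%N≡N∸1⇒[1+m]%N≡0 q))
  ... | no _  | no _   = refl
  coeff-suc m {suc j} 1+j<N with suc m % N ≟ suc j | m % N ≟ j
  ... | yes _ | yes _  = refl
  ... | yes p | no ¬q  = ⊥-elim (¬q ([1+m]%N≡1+j⇒m%N≡j p))
  ... | no ¬p | yes q  = ⊥-elim (¬p (m%N≡j⇒[1+m]%N≡1+j 1+j<N q))
  ... | no _  | no _   = refl

  altSum-zero : ∀ j → altSum α j 0 ≡ δ j
  altSum-zero j = trans (altSum≡binomialSum j 0) (trans (single (coeff j 0)) (coeff-zero j))
    where
      single : ∀ (a : ℤ) → + 0 + a * + 1 ≡ a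
      single = solve-∀

  altSum-suc : ∀ n {j} → j < N → altSum α j (suc n) ≡ T (λ i → altSum α i n) j
  altSum-suc n {j} j<N = begin
    altSum α j (suc n)
      ≡⟨ altSum≡binomialSum j (suc n) ⟩
    binomialSum (coeff j) (suc n)
      ≡⟨ binomialSum-suc (coeff j) n ⟩
    binomialSum (coeff j) n + binomialSum (coeff j ∘ suc) n
      ≡⟨ cong (λ s → binomialSum (coeff j) n + s) (binomialPartial-cong (λ m → coeff-suc m j<N) n (suc n)) ⟩
    binomialSum (coeff j) n + binomialSum (λ m → X (λ i → coeff i m) j) n
      ≡⟨ cong (λ s → binomialSum (coeff j) n + s) (binomialSum-X (λ m i → coeff i m) n j) ⟩
    T (λ i → binomialSum (coeff i) n) j
      ≡⟨ cong₂ _+_ (sym (altSum≡binomialSum j n)) (X-cong (λ i → sym (altSum≡binomialSum i n)) j) ⟩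
    T (λ i → altSum α i n) j ∎
    where open ≡-Reasoning

  T^nδ≡altSum : ∀ n {j} → j < N → (T ^ᶠ n) δ j ≡ altSum α j n
  T^nδ≡altSum zero    {j} _   = sym (altSum-zero j)
  T^nδ≡altSum (suc n)     j<N = trans (T-agree (T^nδ≡altSum n) j<N) (sym (altSum-suc n j<N))

-- The argument also covers α = 0.
proposition5p4 : (α : ℕ) → 0 < α → (j : ℕ) → j < 2 ^ α → (n : ℕ)
    → (+ (2 ^ floorDivPow2 n α)) ∣ altSum α j n
proposition5p4 α _ j j<2^α n =
  ∣⇒∣ᵤ (subst (_ Signed.∣_) (T^nδ≡altSum n j<2^α) (at (T^nδ-∣ α refl n) j<2^α))
  where open AlternatingSum α
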